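{- Let $f$ be an $n$-ary saturated polymorphism of $(\mathbf{LO}_2,\mathbf{LO}_3)$. A boolean set $X$ of $f$ is static if and only if $X\cap T_f\neq\emptyset$.
   Context: $[n]=\{1,\dots,n\}$. $\mathrm{LO}_3\subseteq\{0,1,2\}^3$ is the set of triples whose maximum entry occurs in exactly one coordinate. Identify $X\subseteq[n]$ with the 0/1 tuple having 1 exactly in positions of $X$. $f:\{0,1\}^n\to\{0,1,2\}$ is a polymorphism of $(\mathbf{LO}_2,\mathbf{LO}_3)$ iff for every ordered partition $(X,Y,Z)$ of $[n]$ into three (possibly empty) parts, $(f(X),f(Y),f(Z))\in\mathrm{LO}_3$. $X$ is an $i$-set if $f(X)=i$, a boolean set if $f(X)\in\{0,1\}$. For $i\ne f(X)$, $X$ is $i$-recolourable if changing $f$'s value at $X$ alone to $i$ still yields a polymorphism; a boolean $i$-set ($i\in\{0,1\}$) is static if it is not $(1-i)$-recolourable. $f$ is saturated if every superset of a 2-set is a 2-set and for every $X\subseteq[n]$, $X$ or $[n]\setminus X$ is a 2-set. $T_f$ denotes the union of all inclusion-minimal 2-sets of $f$. -}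

module Defs where

open import Data.Nat using (ℕ)
open import Data.Fin using (Fin; zero; suc; _<_)
open import Data.Fin.Subset using (Subset; _∩_; _∪_; ∁; ⊥; ⊤; _⊆_; _∈_)
open import Data.Bool using (Bool)
open import Data.Bool.Properties using () renaming (_≟_ to _≟ᵇ_)
open import Data.Vec.Properties using (≡-dec)
open import Data.Product using (_×_; Σ; ∃; ∃-syntax)
open import Data.Sum using (_⊎_)
open import Relation.Nullary using (¬_; yes; no)
open import Relation.Binary.PropositionalEquality using (_≡_; _≢_)

Three : Set
Three = Fin 3

c0 c1 c2 : Three
c0 = zero
c1 = suc zero
c2 = suc (suc zero)

LO3 : Three → Three → Three → Set
LO3 a b c = (b < a × c < a) ⊎ (a < b × c < b) ⊎ (a < c × b < c)

IsPartition3 : {n : ℕ} → Subset n → Subset n → Subset n → Set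
IsPartition3 X Y Z =
  (X ∩ Y ≡ ⊥) × (X ∩ Z ≡ ⊥) × (Y ∩ Z ≡ ⊥) × ((X ∪ Y) ∪ Z ≡ ⊤)

IsPolymorphism : {n : ℕ} → (Subset n → Three) → Set
IsPolymorphism {n} f =
  (X Y Z : Subset n) → IsPartition3 X Y Z → LO3 (f X) (f Y) (f Z)

recolour : {n : ℕ} → (Subset n → Three) → Subset n → Three → Subset n → Three
recolour f X i Y with ≡-dec _≟ᵇ_ Y X
... | yes _ = i
... | no _ = f Y

Recolourable : {n : ℕ} → (Subset n → Three) → Subset n → Three → Set
Recolourable f X i = (i ≢ f X) × IsPolymorphism (recolour f X i)

BooleanSet : {n : ℕ} → (Subset n → Three) → Subset n → Set
BooleanSet f X = (f X ≡ c0) ⊎ (f X ≡ c1)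

Static : {n : ℕ} → (Subset n → Three) → Subset n → Set
Static f X = (f X ≡ c0 × ¬ Recolourable f X c1) ⊎ (f X ≡ c1 × ¬ Recolourable f X c0)

Saturated : {n : ℕ} → (Subset n → Three) → Set
Saturated {n} f =
  ((X Y : Subset n) → X ⊆ Y → f X ≡ c2 → f Y ≡ c2)
  × ((X : Subset n) → (f X ≡ c2) ⊎ (f (∁ X) ≡ c2))

Minimal2Set : {n : ℕ} → (Subset n → Three) → Subset n → Set
Minimal2Set {n} f M = (f M ≡ c2) × ((Y : Subset n) → Y ⊆ M → f Y ≡ c2 → Y ≡ M)

-- membership in T_f, the union of all inclusion-minimal 2-sets
InT : {n : ℕ} → (Subset n → Three) → Fin n → Set
InT {n} f x = ∃[ M ] (Minimal2Set f M × x ∈ M)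

MeetsT : {n : ℕ} → (Subset n → Three) → Subset n → Set
MeetsT f X = ∃[ x ] (x ∈ X × InT f x)

-- A boolean set X can change colour unless some partition (X, B, C) has B and
-- C boolean too: then LO3 on the boolean colours is the 1-in-3 relation, which
-- pins down the colour of X. Otherwise every partition through X has exactly
-- one 2-set part, and recolouring X between 0 and 1 keeps all triples in LO3.
-- Such a boolean split (X, B, C) exists exactly when X meets T_f: given one,
-- ∁ C is a 2-set by saturation, and a minimal 2-set M ⊆ ∁ C is not inside B,
-- so it has a point outside B and C, i.e. in X; conversely, for x ∈ X ∩ M the
-- sets ∁ X ∩ M (a proper subset of M) and ∁ X ∩ ∁ M (inside ∁ M) are boolean.
module Submission where

open import Defs
open import Data.Nat using (ℕ; s≤s)
open import Data.Nat.Induction using (<-wellFounded)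
open import Data.Fin using (zero; suc; _<_)
open import Data.Fin.Properties using (≤fromℕ; ≤∧≢⇒<; any?) renaming (_≟_ to _≟ᶠ_)
open import Data.Fin.Subset using (Subset; _∩_; _∪_; ∁; ⊥; ⊤; _⊆_; _⊂_; _∈_; _∉_; ∣_∣)
open import Data.Fin.Subset.Properties
open import Data.Bool.Properties using (_≟_)
open import Data.Vec.Properties using (≡-dec)
open import Data.Product using (_×_; _,_; proj₁; ∃-syntax)
open import Data.Sum using (_⊎_; inj₁; inj₂)
open import Data.Empty using (⊥-elim)
open import Function using (_∘_)
open import Induction.WellFounded using (WellFounded; Acc; acc; module Subrelation)
open import Relation.Binary.Construct.On as On using ()
open import Relation.Binary.Definitions using (DecidableEquality)
open import Relation.Nullary using (¬_; Dec; yes; no; contradiction)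
open import Relation.Nullary.Decidable using (_×-dec_; ¬?; decidable-stable)
open import Relation.Unary using (Pred; Decidable)
open import Relation.Binary.PropositionalEquality
  using (_≡_; _≢_; refl; sym; trans; cong; subst; ≢-sym; module ≡-Reasoning)

≡-≢-trans : ∀ {A : Set} {a b c : A} → a ≡ b → b ≢ c → a ≢ c
≡-≢-trans refl b≢c = b≢c

c2≮ : ∀ {a : Three} → ¬ (c2 < a)
c2≮ {suc zero} (s≤s ())
c2≮ {suc (suc zero)} (s≤s (s≤s ()))

≢c2⇒<c2 : ∀ {a : Three} → a ≢ c2 → a < c2
≢c2⇒<c2 {a} a≢c2 = ≤∧≢⇒< (≤fromℕ a) a≢c2

LO3-rotate : ∀ {a b c} → LO3 a b c → LO3 b c a
LO3-rotate (inj₁ (b<a , c<a)) = inj₂ (inj₂ (b<a , c<a))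
LO3-rotate (inj₂ (inj₁ (a<b , c<b))) = inj₁ (c<b , a<b)
LO3-rotate (inj₂ (inj₂ (a<c , b<c))) = inj₂ (inj₁ (b<c , a<c))

LO3-resp-≡ : ∀ {a a′ b b′ c c′} → a ≡ a′ → b ≡ b′ → c ≡ c′ → LO3 a b c → LO3 a′ b′ c′
LO3-resp-≡ refl refl refl abc = abc

LO3-c2₂ : ∀ {a b c} → a ≢ c2 → b ≡ c2 → c ≢ c2 → LO3 a b c
LO3-c2₂ a≢c2 refl c≢c2 = inj₂ (inj₁ (≢c2⇒<c2 a≢c2 , ≢c2⇒<c2 c≢c2))

LO3-c2₃ : ∀ {a b c} → a ≢ c2 → b ≢ c2 → c ≡ c2 → LO3 a b c
LO3-c2₃ a≢c2 b≢c2 refl = inj₂ (inj₂ (≢c2⇒<c2 a≢c2 , ≢c2⇒<c2 b≢c2))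

¬LO3-c2-c2 : ∀ {a b c} → b ≡ c2 → c ≡ c2 → ¬ LO3 a b c
¬LO3-c2-c2 refl refl (inj₁ (c2<a , _)) = c2≮ c2<a
¬LO3-c2-c2 refl refl (inj₂ (inj₁ (_ , c2<c2))) = c2≮ c2<c2
¬LO3-c2-c2 refl refl (inj₂ (inj₂ (_ , c2<c2))) = c2≮ c2<c2

data OneInThree : Three → Three → Three → Set where
  one₁ : OneInThree c1 c0 c0
  one₂ : OneInThree c0 c1 c0
  one₃ : OneInThree c0 c0 c1

<-boolean : ∀ {a b : Three} → b < a → a ≢ c2 → a ≡ c1 × b ≡ c0
<-boolean {suc zero} {zero} _ _ = refl , refl
<-boolean {suc zero} {suc _} (s≤s ())
<-boolean {suc (suc zero)} _ a≢c2 = contradiction refl a≢c2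

LO3⇒OneInThree : ∀ {a b c} → a ≢ c2 → b ≢ c2 → c ≢ c2 → LO3 a b c → OneInThree a b c
LO3⇒OneInThree a≢c2 _ _ (inj₁ (b<a , c<a))
  with <-boolean b<a a≢c2 | <-boolean c<a a≢c2
... | refl , refl | _ , refl = one₁
LO3⇒OneInThree _ b≢c2 _ (inj₂ (inj₁ (a<b , c<b)))
  with <-boolean a<b b≢c2 | <-boolean c<b b≢c2
... | refl , refl | _ , refl = one₂
LO3⇒OneInThree _ _ c≢c2 (inj₂ (inj₂ (a<c , b<c)))
  with <-boolean a<c c≢c2 | <-boolean b<c c≢c2
... | refl , refl | _ , refl = one₃

OneInThree-functional₁ : ∀ {a a′ b c} → OneInThree a b c → OneInThree a′ b c → a ≡ a′
OneInThree-functional₁ one₁ one₁ = refl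
OneInThree-functional₁ one₂ one₂ = refl
OneInThree-functional₁ one₃ one₃ = refl

module _ {n : ℕ} where

  infix 4 _≟ˢ_
  _≟ˢ_ : DecidableEquality (Subset n)
  _≟ˢ_ = ≡-dec _≟_

  ⊈⇒∃∉ : ∀ {p q : Subset n} → ¬ (p ⊆ q) → ∃[ x ] (x ∈ p × x ∉ q)
  ⊈⇒∃∉ {p} {q} p⊈q with any? (λ x → x ∈? p ×-dec ¬? (x ∈? q))
  ... | yes witness = witness
  ... | no none = ⊥-elim (p⊈q p⊆q)
    where
    p⊆q : p ⊆ q
    p⊆q {x} x∈p = decidable-stable (x ∈? q) (λ x∉q → none (x , x∈p , x∉q))

  ⊂-wellFounded : WellFounded (_⊂_ {n})
  ⊂-wellFounded = Subrelation.wellFounded p⊂q⇒∣p∣<∣q∣ (On.wellFounded ∣_∣ <-wellFounded)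

  minimal-⊆ : ∀ {ℓ} {P : Pred (Subset n) ℓ} → Decidable P → ∀ {S} → P S →
              ∃[ M ] (M ⊆ S × P M × (∀ Y → Y ⊆ M → P Y → Y ≡ M))
  minimal-⊆ {P = P} P? PS = go (⊂-wellFounded _) PS
    where
    go : ∀ {S} → Acc _⊂_ S → P S → ∃[ M ] (M ⊆ S × P M × (∀ Y → Y ⊆ M → P Y → Y ≡ M))
    go {S} (acc smaller) PS with anySubset? (λ Y → Y ⊂? S ×-dec P? Y)
    ... | yes (Y , Y⊂S@(Y⊆S , _) , PY) =
      let M , M⊆Y , PM , minimal = go (smaller Y⊂S) PY in M , ⊆-trans M⊆Y Y⊆S , PM , minimal
    ... | no noProperSubset = S , ⊆-refl , PS , minimal
      where
      minimal : ∀ Y → Y ⊆ S → P Y → Y ≡ S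
      minimal Y Y⊆S PY with S ⊆? Y
      ... | yes S⊆Y = ⊆-antisym Y⊆S S⊆Y
      ... | no S⊈Y = contradiction (Y , ((λ {_} → Y⊆S) , ⊈⇒∃∉ S⊈Y) , PY) noProperSubset

  module _ {A B C : Subset n} where

    partition-rotate : IsPartition3 A B C → IsPartition3 B C A
    partition-rotate (A∩B≡⊥ , A∩C≡⊥ , B∩C≡⊥ , cover) =
      B∩C≡⊥ , trans (∩-comm B A) A∩B≡⊥ , trans (∩-comm C A) A∩C≡⊥ ,
      (begin
        (B ∪ C) ∪ A  ≡⟨ ∪-comm (B ∪ C) A ⟩
        A ∪ (B ∪ C)  ≡⟨ ∪-assoc A B C ⟨
        (A ∪ B) ∪ C  ≡⟨ cover ⟩
        ⊤            ∎)
      where open ≡-Reasoning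

    partition-cover : IsPartition3 A B C → ∀ {x} → x ∉ B → x ∉ C → x ∈ A
    partition-cover (_ , _ , _ , cover) {x} x∉B x∉C
      with x∈p∪q⁻ (A ∪ B) C (subst (x ∈_) (sym cover) ∈⊤)
    ... | inj₂ x∈C = contradiction x∈C x∉C
    ... | inj₁ x∈A∪B with x∈p∪q⁻ A B x∈A∪B
    ...   | inj₁ x∈A = x∈A
    ...   | inj₂ x∈B = contradiction x∈B x∉B

  disjoint⇒≢ : ∀ {A B : Subset n} {x} → A ∩ B ≡ ⊥ → x ∈ A → A ≢ B
  disjoint⇒≢ {x = x} A∩A≡⊥ x∈A refl = ∉⊥ (subst (x ∈_) A∩A≡⊥ (x∈p∩q⁺ (x∈A , x∈A)))

  p∩[∁p∩q]≡⊥ : ∀ (p q : Subset n) → p ∩ (∁ p ∩ q) ≡ ⊥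
  p∩[∁p∩q]≡⊥ p q = begin
    p ∩ (∁ p ∩ q)  ≡⟨ ∩-assoc p (∁ p) q ⟨
    (p ∩ ∁ p) ∩ q  ≡⟨ cong (_∩ q) (∩-inverseʳ p) ⟩
    ⊥ ∩ q          ≡⟨ ∩-zeroˡ q ⟩
    ⊥              ∎
    where open ≡-Reasoning

  complement-partition : ∀ (M : Subset n) → IsPartition3 ⊥ M (∁ M)
  complement-partition M =
    ∩-zeroˡ M , ∩-zeroˡ (∁ M) , ∩-inverseʳ M ,
    trans (cong (_∪ ∁ M) (∪-identityˡ M)) (∪-inverseʳ M)

  complement-split-partition : ∀ (X M : Subset n) → IsPartition3 X (∁ X ∩ M) (∁ X ∩ ∁ M)
  complement-split-partition X M =
    p∩[∁p∩q]≡⊥ X M , p∩[∁p∩q]≡⊥ X (∁ M) , parts-disjoint , cover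
    where
    open ≡-Reasoning
    parts-disjoint : (∁ X ∩ M) ∩ (∁ X ∩ ∁ M) ≡ ⊥
    parts-disjoint = begin
      (∁ X ∩ M) ∩ (∁ X ∩ ∁ M)  ≡⟨ ∩-assoc (∁ X) M (∁ X ∩ ∁ M) ⟩
      ∁ X ∩ (M ∩ (∁ X ∩ ∁ M))  ≡⟨ cong (λ Y → ∁ X ∩ (M ∩ Y)) (∩-comm (∁ X) (∁ M)) ⟩
      ∁ X ∩ (M ∩ (∁ M ∩ ∁ X))  ≡⟨ cong (∁ X ∩_) (p∩[∁p∩q]≡⊥ M (∁ X)) ⟩
      ∁ X ∩ ⊥                  ≡⟨ ∩-zeroʳ (∁ X) ⟩
      ⊥                        ∎
    cover : (X ∪ (∁ X ∩ M)) ∪ (∁ X ∩ ∁ M) ≡ ⊤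
    cover = begin
      (X ∪ (∁ X ∩ M)) ∪ (∁ X ∩ ∁ M)  ≡⟨ ∪-assoc X (∁ X ∩ M) (∁ X ∩ ∁ M) ⟩
      X ∪ ((∁ X ∩ M) ∪ (∁ X ∩ ∁ M))  ≡⟨ cong (X ∪_) (∩-distribˡ-∪ (∁ X) M (∁ M)) ⟨
      X ∪ (∁ X ∩ (M ∪ ∁ M))          ≡⟨ cong (λ Y → X ∪ (∁ X ∩ Y)) (∪-inverseʳ M) ⟩
      X ∪ (∁ X ∩ ⊤)                  ≡⟨ cong (X ∪_) (∩-identityʳ (∁ X)) ⟩
      X ∪ ∁ X                        ≡⟨ ∪-inverseʳ X ⟩
      ⊤                              ∎

module Recolouring {n : ℕ} (f : Subset n → Three) (X : Subset n) (i : Three) where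

  recolour-at : recolour f X i X ≡ i
  recolour-at with X ≟ˢ X
  ... | yes _ = refl
  ... | no X≢X = contradiction refl X≢X

  recolour-elsewhere : ∀ {Y} → Y ≢ X → recolour f X i Y ≡ f Y
  recolour-elsewhere {Y} Y≢X with Y ≟ˢ X
  ... | yes Y≡X = contradiction Y≡X Y≢X
  ... | no _ = refl

  recolour-preserves-c2 : f X ≢ c2 → ∀ {Y} → f Y ≡ c2 → recolour f X i Y ≡ c2
  recolour-preserves-c2 fX≢c2 fY≡c2 =
    trans (recolour-elsewhere (λ { refl → fX≢c2 fY≡c2 })) fY≡c2

  recolour-reflects-c2 : i ≢ c2 → ∀ {Y} → f Y ≢ c2 → recolour f X i Y ≢ c2
  recolour-reflects-c2 i≢c2 {Y} fY≢c2 with Y ≟ˢ X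
  ... | yes _ = i≢c2
  ... | no _ = fY≢c2

BooleanSplit : {n : ℕ} → (Subset n → Three) → Subset n → Set
BooleanSplit f X = ∃[ B ] ∃[ C ] (IsPartition3 X B C × f B ≢ c2 × f C ≢ c2)

booleanSplit? : {n : ℕ} (f : Subset n → Three) (X : Subset n) → Dec (BooleanSplit f X)
booleanSplit? f X = anySubset? λ B → anySubset? λ C →
  isPartition3? B C ×-dec ¬? (f B ≟ᶠ c2) ×-dec ¬? (f C ≟ᶠ c2)
  where
  isPartition3? : ∀ B C → Dec (IsPartition3 X B C)
  isPartition3? B C = (X ∩ B ≟ˢ ⊥) ×-dec (X ∩ C ≟ˢ ⊥) ×-dec (B ∩ C ≟ˢ ⊥) ×-dec ((X ∪ B) ∪ C ≟ˢ ⊤)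

¬2-set⇒∁-2-set : ∀ {n} {f : Subset n → Three} → (∀ Y → f Y ≡ c2 ⊎ f (∁ Y) ≡ c2) →
                           ∀ {Y} → f Y ≢ c2 → f (∁ Y) ≡ c2
¬2-set⇒∁-2-set complement {Y} fY≢c2 with complement Y
... | inj₁ fY≡c2 = contradiction fY≡c2 fY≢c2
... | inj₂ f∁Y≡c2 = f∁Y≡c2

module _ {n : ℕ} {f : Subset n → Three} (poly : IsPolymorphism f) where

  2-set⇒∁-¬2-set : ∀ {M} → f M ≡ c2 → f (∁ M) ≢ c2
  2-set⇒∁-¬2-set {M} fM≡c2 f∁M≡c2 =
    ¬LO3-c2-c2 fM≡c2 f∁M≡c2 (poly ⊥ M (∁ M) (complement-partition M))

  unsplit⇒recolour-polymorphism : ∀ {X j} → f X ≢ c2 → j ≢ c2 → ¬ BooleanSplit f X →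
                                  IsPolymorphism (recolour f X j)
  unsplit⇒recolour-polymorphism {X} {j} fX≢c2 j≢c2 unsplit = polymorphism
    where
    open Recolouring f X j

    g : Subset n → Three
    g = recolour f X j

    at-X : ∀ {B C} → IsPartition3 X B C → LO3 (g X) (g B) (g C)
    at-X {B} {C} p with f B ≟ᶠ c2 | f C ≟ᶠ c2
    ... | yes fB≡c2 | _ =
      LO3-c2₂ (recolour-reflects-c2 j≢c2 fX≢c2) (recolour-preserves-c2 fX≢c2 fB≡c2)
              (recolour-reflects-c2 j≢c2 (λ fC≡c2 → ¬LO3-c2-c2 fB≡c2 fC≡c2 (poly X B C p)))
    ... | no fB≢c2 | yes fC≡c2 =
      LO3-c2₃ (recolour-reflects-c2 j≢c2 fX≢c2) (recolour-reflects-c2 j≢c2 fB≢c2)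
              (recolour-preserves-c2 fX≢c2 fC≡c2)
    ... | no fB≢c2 | no fC≢c2 = contradiction (B , C , p , fB≢c2 , fC≢c2) unsplit

    by-position : ∀ A B C → IsPartition3 A B C → Dec (A ≡ X) → Dec (B ≡ X) → Dec (C ≡ X) →
                  LO3 (g A) (g B) (g C)
    by-position _ _ _ p (yes refl) _ _ = at-X p
    by-position _ _ _ p _ (yes refl) _ = LO3-rotate (LO3-rotate (at-X (partition-rotate p)))
    by-position _ _ _ p _ _ (yes refl) = LO3-rotate (at-X (partition-rotate (partition-rotate p)))
    by-position A B C p (no A≢X) (no B≢X) (no C≢X) =
      LO3-resp-≡ (sym (recolour-elsewhere A≢X)) (sym (recolour-elsewhere B≢X))
                 (sym (recolour-elsewhere C≢X)) (poly A B C p)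

    polymorphism : IsPolymorphism g
    polymorphism A B C p = by-position A B C p (A ≟ˢ X) (B ≟ˢ X) (C ≟ˢ X)

  split⇒recolour-fixed : ∀ {X j x} → x ∈ X → BooleanSplit f X → f X ≢ c2 → j ≢ c2 →
                         IsPolymorphism (recolour f X j) → j ≡ f X
  split⇒recolour-fixed {X} {j} x∈X (B , C , p@(X∩B≡⊥ , X∩C≡⊥ , _) , fB≢c2 , fC≢c2)
                       fX≢c2 j≢c2 g-poly =
    OneInThree-functional₁ (LO3⇒OneInThree j≢c2 fB≢c2 fC≢c2 recoloured)
                           (LO3⇒OneInThree fX≢c2 fB≢c2 fC≢c2 (poly X B C p))
    where
    open Recolouring f X j
    recoloured : LO3 j (f B) (f C)
    recoloured =
      LO3-resp-≡ recolour-at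
                 (recolour-elsewhere (≢-sym (disjoint⇒≢ X∩B≡⊥ x∈X)))
                 (recolour-elsewhere (≢-sym (disjoint⇒≢ X∩C≡⊥ x∈X)))
                 (g-poly X B C p)

split⇒meetsT : ∀ {n} {f : Subset n → Three} → Saturated f → ∀ {X} → BooleanSplit f X → MeetsT f X
split⇒meetsT {f = f} (upward , complement) (B , C , p , fB≢c2 , fC≢c2)
  with minimal-⊆ (λ Y → f Y ≟ᶠ c2) (¬2-set⇒∁-2-set complement fC≢c2)
... | M , M⊆∁C , fM≡c2 , minimal with ⊈⇒∃∉ (λ M⊆B → fB≢c2 (upward M B M⊆B fM≡c2))
...   | x , x∈M , x∉B =
  x , partition-cover p x∉B (x∈∁p⇒x∉p (M⊆∁C x∈M)) , M , (fM≡c2 , minimal) , x∈M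

module _ {n : ℕ} {f : Subset n → Three} (poly : IsPolymorphism f) where

  meetsT⇒split : Saturated f → ∀ {X} → MeetsT f X → BooleanSplit f X
  meetsT⇒split (upward , _) {X} (x , x∈X , M , (fM≡c2 , minimal) , x∈M) =
    ∁ X ∩ M , ∁ X ∩ ∁ M , complement-split-partition X M , inside≢c2 , outside≢c2
    where
    inside≢c2 : f (∁ X ∩ M) ≢ c2
    inside≢c2 f[∁X∩M]≡c2 =
      x∈∁p⇒x∉p (proj₁ (x∈p∩q⁻ (∁ X) M (subst (x ∈_) (sym ∁X∩M≡M) x∈M))) x∈X
      where
      ∁X∩M≡M : ∁ X ∩ M ≡ M
      ∁X∩M≡M = minimal (∁ X ∩ M) (p∩q⊆q (∁ X) M) f[∁X∩M]≡c2

    outside≢c2 : f (∁ X ∩ ∁ M) ≢ c2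
    outside≢c2 f[∁X∩∁M]≡c2 =
      2-set⇒∁-¬2-set poly fM≡c2 (upward (∁ X ∩ ∁ M) (∁ M) (p∩q⊆q (∁ X) (∁ M)) f[∁X∩∁M]≡c2)

  static⇒split : ∀ {X} → Static f X → BooleanSplit f X
  static⇒split {X} static =
    decidable-stable (booleanSplit? f X) (λ unsplit → not-static unsplit static)
    where
    recolourable : ∀ {i j} → ¬ BooleanSplit f X → f X ≡ i → i ≢ c2 → j ≢ c2 → j ≢ i →
                   Recolourable f X j
    recolourable unsplit fX≡i i≢c2 j≢c2 j≢i =
      ≢-sym (≡-≢-trans fX≡i (≢-sym j≢i)) ,
      unsplit⇒recolour-polymorphism poly (≡-≢-trans fX≡i i≢c2) j≢c2 unsplit

    not-static : ¬ BooleanSplit f X → ¬ Static f X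
    not-static unsplit (inj₁ (fX≡c0 , ¬recolourable)) =
      ¬recolourable (recolourable unsplit fX≡c0 (λ ()) (λ ()) (λ ()))
    not-static unsplit (inj₂ (fX≡c1 , ¬recolourable)) =
      ¬recolourable (recolourable unsplit fX≡c1 (λ ()) (λ ()) (λ ()))

  split⇒static : ∀ {X x} → x ∈ X → BooleanSplit f X → BooleanSet f X → Static f X
  split⇒static x∈X split (inj₁ fX≡c0) =
    inj₁ (fX≡c0 , λ (c1≢fX , recoloured) →
      c1≢fX (split⇒recolour-fixed poly x∈X split (≡-≢-trans fX≡c0 (λ ())) (λ ()) recoloured))
  split⇒static x∈X split (inj₂ fX≡c1) =
    inj₂ (fX≡c1 , λ (c0≢fX , recoloured) →
      c0≢fX (split⇒recolour-fixed poly x∈X split (≡-≢-trans fX≡c1 (λ ())) (λ ()) recoloured))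

mainTheorem9 : (n : ℕ) (f : Subset n → Three) → IsPolymorphism f → Saturated f →
               (X : Subset n) → BooleanSet f X →
               (Static f X → MeetsT f X) × (MeetsT f X → Static f X)
mainTheorem9 _ _ poly sat _ boolean =
  split⇒meetsT sat ∘ static⇒split poly ,
  λ meets@(x , x∈X , _) → split⇒static poly x∈X (meetsT⇒split poly sat meets) boolean
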